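{- Let $n \geq 2$, let $D = (d_1, \ldots, d_n)$ be a nondecreasing sequence of nonnegative integers, and let $h = \lceil d_n/(n-1) \rceil$. Then: (i) there exists a loopless directed multigraph with point matrix $(m_{ij})$ and out-degree sequence $D$ such that $\max_{i,j} m_{ij} \leq h$ and $m_{ij} + m_{ji} \leq 2h$ for all $i \neq j$ (so it is a $(0,2h,n)$-tournament); (ii) every loopless directed multigraph with out-degree sequence $D$ satisfies $\max_{i,j} m_{ij} \geq h$, so $h$ cannot be replaced by a smaller bound; (iii) the bound $2h$ cannot be improved in general: there are nondecreasing sequences $D$ (for example $d_1 = \cdots = d_n = 2n(n-1)$) such that every loopless directed multigraph with out-degree sequence $D$ has $\max_{i<j}(m_{ij}+m_{ji}) \geq 2h$.
   Context: A loopless directed multigraph on players $P_1,\ldots,P_n$ is given by nonnegative integers $m_{ij}$ with $m_{ii}=0$ ($m_{ij}$ = number of arcs from $P_i$ to $P_j$); its out-degree sequence is $(d_1,\ldots,d_n)$ with $d_i = \sum_j m_{ij}$. For integers $0\le a\le b$, an $(a,b,n)$-tournament is such a multigraph with $a \leq m_{ij}+m_{ji} \leq b$ for all $i\neq j$. -}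

module Defs where

open import Data.Nat using (ℕ; zero; suc; _+_; _∸_; _≤_; z≤n; s≤s)
open import Data.Nat.DivMod using (_/_)
open import Data.Fin using (Fin; zero; suc)
import Data.Fin as F
open import Relation.Binary.PropositionalEquality using (_≡_)

sumFin : ∀ {n} → (Fin n → ℕ) → ℕ
sumFin {zero}  f = 0
sumFin {suc n} f = f zero + sumFin (λ i → f (suc i))

-- ceiling division: ceilDiv a b = ⌈ a / b ⌉ for b ≥ 1 (value 0 when b = 0, never used)
ceilDiv : ℕ → ℕ → ℕ
ceilDiv a zero    = 0
ceilDiv a (suc b) = (a + b) / suc b

-- a point matrix m i j = number of arcs from P_i to P_j
Matrix : ℕ → Set
Matrix n = Fin n → Fin n → ℕ

Loopless : ∀ {n} → Matrix n → Set
Loopless m = ∀ i → m i i ≡ 0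

outDeg : ∀ {n} → Matrix n → Fin n → ℕ
outDeg m i = sumFin (m i)

HasOutDegSeq : ∀ {n} → Matrix n → (Fin n → ℕ) → Set
HasOutDegSeq m D = ∀ i → outDeg m i ≡ D i

NonDecreasing : ∀ {n} → (Fin n → ℕ) → Set
NonDecreasing D = ∀ i j → i F.≤ j → D i ≤ D j

lastIdx : ∀ {n} → 2 ≤ n → Fin n
lastIdx {suc n} (s≤s _) = F.fromℕ n

hOf : ∀ n → 2 ≤ n → (Fin n → ℕ) → ℕ
hOf n p D = ceilDiv (D (lastIdx p)) (n ∸ 1)

module Submission where

-- Write n = k + 2 players (n ≥ 2), so every row of a point matrix has
-- b = k + 1 = n − 1 off-diagonal slots, and h = ⌈d_n / b⌉.
--
-- (i)   Every d_i ≤ d_n ≤ b·h since D is nondecreasing.  A value d ≤ b·h is split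
--       greedily into b parts of size ≤ h (fillRow); putting a 0 on the diagonal
--       (insertZero) turns these rows into a loopless matrix with out-degrees D and
--       all entries ≤ h (realise), hence all pair sums ≤ 2h.
-- (ii)  A loopless row whose entries are all ≤ c has sum ≤ b·c (zeroEntry-sum-bound);
--       by minimality of the ceiling (ceilDiv-least) the row of any player i must
--       then contain an entry ≥ ⌈d_i / b⌉ (large-entry).  Apply this to P_n.
-- (iii) Counting every arc from both of its ends (double-count) shows that if all
--       pair sums are ≤ c then 2·Σ d_i ≤ n·b·c (handshake-bound), so a larger total
--       forces a heavy pair (heavy-pair).  For d_i = 2nb we get h = 2n
--       (ceilDiv-exact) and 2·Σ d_i = n·b·4n > n·b·(4n − 1).

open import Defs
open import Data.Nat using (ℕ; zero; suc; _≤_; _<_; _*_; _∸_; _+_; _⊓_; z≤n; s≤s; s≤s⁻¹; _≤?_)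
open import Data.Nat.Properties
open import Data.Nat.DivMod using (_/_; _%_; m≡m%n+[m/n]*n; m%n<n; m<n*o⇒m/o<n)
open import Data.Nat.Solver using (module +-*-Solver)
open import Data.Fin using (Fin; zero; suc)
import Data.Fin as F
import Data.Fin.Properties as FP
open import Data.Product using (Σ; _×_; ∃; _,_; proj₁; proj₂)
open import Data.Empty using (⊥-elim)
open import Relation.Nullary using (yes; no)
open import Relation.Nullary.Decidable using (_×-dec_)
open import Relation.Binary using (tri<; tri≈; tri>)
open import Relation.Binary.PropositionalEquality
  using (_≡_; _≢_; refl; sym; trans; cong; cong₂; subst; module ≡-Reasoning)

sumFin-cong : ∀ {n} {f g : Fin n → ℕ} → (∀ i → f i ≡ g i) → sumFin f ≡ sumFin g
sumFin-cong {zero}  e = refl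
sumFin-cong {suc n} e = cong₂ _+_ (e zero) (sumFin-cong (λ i → e (suc i)))

sumFin-mono : ∀ {n} {f g : Fin n → ℕ} → (∀ i → f i ≤ g i) → sumFin f ≤ sumFin g
sumFin-mono {zero}  e = z≤n
sumFin-mono {suc n} e = +-mono-≤ (e zero) (sumFin-mono (λ i → e (suc i)))

sumFin-const : ∀ n c → sumFin {n} (λ _ → c) ≡ n * c
sumFin-const zero    c = refl
sumFin-const (suc n) c = cong (c +_) (sumFin-const n c)

sumFin-+ : ∀ {n} (f g : Fin n → ℕ) → sumFin (λ i → f i + g i) ≡ sumFin f + sumFin g
sumFin-+ {zero}  f g = refl
sumFin-+ {suc n} f g = begin
    (f zero + g zero) + sumFin (λ i → f (suc i) + g (suc i))
  ≡⟨ cong (f zero + g zero +_) (sumFin-+ (λ i → f (suc i)) (λ i → g (suc i))) ⟩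
    (f zero + g zero) + (F' + G')
  ≡⟨ +-*-Solver.solve 4 (λ a b c d → (a :+ b) :+ (c :+ d) := (a :+ c) :+ (b :+ d))
       refl (f zero) (g zero) F' G' ⟩
    (f zero + F') + (g zero + G')
  ∎
  where
  open ≡-Reasoning
  open +-*-Solver using (_:+_; _:=_)
  F' = sumFin (λ i → f (suc i))
  G' = sumFin (λ i → g (suc i))

sumFin-swap : ∀ {a b} (f : Fin a → Fin b → ℕ)
  → sumFin (λ i → sumFin (f i)) ≡ sumFin (λ j → sumFin (λ i → f i j))
sumFin-swap {zero}  {b} f = sym (trans (sumFin-const b 0) (*-zeroʳ b))
sumFin-swap {suc a} f =
  trans (cong (sumFin (f zero) +_) (sumFin-swap (λ i → f (suc i))))
        (sym (sumFin-+ (f zero) (λ j → sumFin (λ i → f (suc i) j))))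

zeroEntry-sum-bound : ∀ {k} (f : Fin (suc k) → ℕ) (i : Fin (suc k)) c
  → f i ≡ 0 → (∀ j → i ≢ j → f j ≤ c) → sumFin f ≤ k * c
zeroEntry-sum-bound {k} f zero c fi≡0 le rewrite fi≡0 =
  subst (_ ≤_) (sumFin-const k c) (sumFin-mono (λ j → le (suc j) (λ ())))
zeroEntry-sum-bound {suc k} f (suc i) c fi≡0 le =
  +-mono-≤ (le zero (λ ()))
    (zeroEntry-sum-bound (λ j → f (suc j)) i c fi≡0
      (λ j i≢j → le (suc j) (λ e → i≢j (FP.suc-injective e))))

ceilDiv-upper : ∀ k d → d ≤ suc k * ceilDiv d (suc k)
ceilDiv-upper k d = +-cancelˡ-≤ k d (suc k * q) (begin
    k + d                        ≡⟨ +-comm k d ⟩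
    d + k                        ≡⟨ m≡m%n+[m/n]*n (d + k) (suc k) ⟩
    (d + k) % suc k + q * suc k  ≤⟨ +-monoˡ-≤ (q * suc k) (s≤s⁻¹ (m%n<n (d + k) (suc k))) ⟩
    k + q * suc k                ≡⟨ cong (k +_) (*-comm q (suc k)) ⟩
    k + suc k * q                ∎)
  where
  open ≤-Reasoning
  q = ceilDiv d (suc k)

ceilDiv-least : ∀ k d q → d ≤ suc k * q → ceilDiv d (suc k) ≤ q
ceilDiv-least k d q d≤bq = s≤s⁻¹ (m<n*o⇒m/o<n (begin-strict
    d + k            <⟨ +-monoʳ-< d (n<1+n k) ⟩
    d + suc k        ≤⟨ +-monoˡ-≤ (suc k) d≤bq ⟩
    suc k * q + suc k ≡⟨ +-comm (suc k * q) (suc k) ⟩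
    suc k + suc k * q ≡⟨ sym (*-suc (suc k) q) ⟩
    suc k * suc q    ≡⟨ *-comm (suc k) (suc q) ⟩
    suc q * suc k    ∎))
  where open ≤-Reasoning

ceilDiv-exact : ∀ k q → ceilDiv (suc k * q) (suc k) ≡ q
ceilDiv-exact k q = ≤-antisym (ceilDiv-least k _ q ≤-refl)
                              (*-cancelˡ-≤ (suc k) (ceilDiv-upper k (suc k * q)))

fillRow : ∀ k d h → d ≤ k * h → Σ (Fin k → ℕ) (λ f → sumFin f ≡ d × (∀ j → f j ≤ h))
fillRow zero    zero    h _    = (λ ()) , refl , (λ ())
fillRow (suc k) d       h d≤kh with fillRow k (d ∸ h) h (m≤n+o⇒m∸n≤o d h d≤kh)
... | f , sum≡ , f≤h =
  (λ { zero → h ⊓ d ; (suc j) → f j }) ,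
  trans (cong (h ⊓ d +_) sum≡) (m⊓n+n∸m≡n h d) ,
  (λ { zero → m⊓n≤m h d ; (suc j) → f≤h j })

insertZero : ∀ {k} → Fin (suc k) → (Fin k → ℕ) → Fin (suc k) → ℕ
insertZero zero f zero    = 0
insertZero zero f (suc j) = f j
insertZero {suc k} (suc i) f zero    = f zero
insertZero {suc k} (suc i) f (suc j) = insertZero i (λ x → f (suc x)) j

insertZero-diag : ∀ {k} (i : Fin (suc k)) f → insertZero i f i ≡ 0
insertZero-diag zero f = refl
insertZero-diag {suc k} (suc i) f = insertZero-diag i (λ x → f (suc x))

insertZero-sum : ∀ {k} (i : Fin (suc k)) f → sumFin (insertZero i f) ≡ sumFin f
insertZero-sum zero f = refl
insertZero-sum {suc k} (suc i) f = cong (f zero +_) (insertZero-sum i (λ x → f (suc x)))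

insertZero-≤ : ∀ {k} (i : Fin (suc k)) f h → (∀ j → f j ≤ h) → ∀ j → insertZero i f j ≤ h
insertZero-≤ zero f h f≤h zero    = z≤n
insertZero-≤ zero f h f≤h (suc j) = f≤h j
insertZero-≤ {suc k} (suc i) f h f≤h zero    = f≤h zero
insertZero-≤ {suc k} (suc i) f h f≤h (suc j) =
  insertZero-≤ i (λ x → f (suc x)) h (λ x → f≤h (suc x)) j

realise : ∀ {k} h (D : Fin (suc k) → ℕ) → (∀ i → D i ≤ k * h)
  → Σ (Matrix (suc k)) (λ m → Loopless m × HasOutDegSeq m D × (∀ i j → m i j ≤ h))
realise {k} h D D≤kh =
  m ,
  (λ i → insertZero-diag i (row i)) ,
  (λ i → trans (insertZero-sum i (row i)) (proj₁ (proj₂ (filled i)))) ,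
  (λ i → insertZero-≤ i (row i) h (proj₂ (proj₂ (filled i))))
  where
  filled : ∀ i → Σ (Fin k → ℕ) (λ f → sumFin f ≡ D i × (∀ j → f j ≤ h))
  filled i = fillRow k (D i) h (D≤kh i)
  row : Fin (suc k) → Fin k → ℕ
  row i = proj₁ (filled i)
  m : Matrix (suc k)
  m i = insertZero i (row i)

large-entry : ∀ {k} (m : Matrix (suc (suc k))) → Loopless m
  → ∀ i → ∃ (λ j → ceilDiv (outDeg m i) (suc k) ≤ m i j)
large-entry {k} m loopless i with ceilDiv (outDeg m i) (suc k) in h≡
... | zero  = i , z≤n
... | suc q with FP.any? (λ j → suc q ≤? m i j)
...   | yes found = found
...   | no  none  = ⊥-elim (1+n≰n (subst (_≤ q) h≡ (ceilDiv-least k (outDeg m i) q row≤)))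
  where
  row≤ : outDeg m i ≤ suc k * q
  row≤ = zeroEntry-sum-bound (m i) i q (loopless i)
           (λ j _ → s≤s⁻¹ (≰⇒> (λ le → none (j , le))))

totalOut : ∀ {n} → Matrix n → ℕ
totalOut m = sumFin (outDeg m)

double-count : ∀ {n} (m : Matrix n)
  → sumFin (λ i → sumFin (λ j → m i j + m j i)) ≡ 2 * totalOut m
double-count m = begin
    sumFin (λ i → sumFin (λ j → m i j + m j i))
  ≡⟨ sumFin-cong (λ i → sumFin-+ (m i) (λ j → m j i)) ⟩
    sumFin (λ i → outDeg m i + sumFin (λ j → m j i))
  ≡⟨ sumFin-+ (outDeg m) (λ i → sumFin (λ j → m j i)) ⟩
    totalOut m + sumFin (λ i → sumFin (λ j → m j i))
  ≡⟨ cong (totalOut m +_) (sym (sumFin-swap m)) ⟩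
    totalOut m + totalOut m
  ≡⟨ cong (totalOut m +_) (sym (+-identityʳ (totalOut m))) ⟩
    2 * totalOut m
  ∎
  where open ≡-Reasoning

handshake-bound : ∀ {k} (m : Matrix (suc k)) c → Loopless m
  → (∀ i j → i ≢ j → m i j + m j i ≤ c) → 2 * totalOut m ≤ suc k * (k * c)
handshake-bound {k} m c loopless pair≤ = begin
    2 * totalOut m                               ≡⟨ double-count m ⟨
    sumFin (λ i → sumFin (λ j → m i j + m j i))  ≤⟨ sumFin-mono row≤ ⟩
    sumFin {suc k} (λ _ → k * c)                 ≡⟨ sumFin-const (suc k) (k * c) ⟩
    suc k * (k * c)                              ∎
  where
  open ≤-Reasoning
  row≤ : ∀ i → sumFin (λ j → m i j + m j i) ≤ k * c
  row≤ i = zeroEntry-sum-bound (λ j → m i j + m j i) i c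
             (cong₂ _+_ (loopless i) (loopless i)) (pair≤ i)

heavy-pair : ∀ {k} (m : Matrix (suc k)) c → Loopless m
  → suc k * (k * c) < 2 * totalOut m
  → ∃ (λ i → ∃ (λ j → i F.< j × c < m i j + m j i))
heavy-pair m c loopless large
  with FP.any? (λ i → FP.any? (λ j → (i FP.<? j) ×-dec (suc c ≤? m i j + m j i)))
... | yes found = found
... | no  none  = ⊥-elim (<⇒≱ large (handshake-bound m c loopless pair≤))
  where
  light : ∀ {i j} → i F.< j → m i j + m j i ≤ c
  light {i} {j} i<j = s≤s⁻¹ (≰⇒> (λ heavy → none (i , j , i<j , heavy)))
  pair≤ : ∀ i j → i ≢ j → m i j + m j i ≤ c
  pair≤ i j i≢j with FP.<-cmp i j
  ... | tri< i<j _ _ = light i<j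
  ... | tri≈ _ i≡j _ = ⊥-elim (i≢j i≡j)
  ... | tri> _ _ j<i = subst (_≤ c) (+-comm (m j i) (m i j)) (light j<i)

lemma2 : (n : ℕ) → (p : 2 ≤ n)
    → ((D : Fin n → ℕ) → NonDecreasing D
        → Σ (Matrix n) (λ m → Loopless m × HasOutDegSeq m D
            × (∀ i j → m i j ≤ hOf n p D)
            × (∀ i j → i ≢ j → m i j + m j i ≤ 2 * hOf n p D)))
    × ((D : Fin n → ℕ) → NonDecreasing D
        → (m : Matrix n) → Loopless m → HasOutDegSeq m D
        → ∃ (λ i → ∃ (λ j → hOf n p D ≤ m i j)))
    × (NonDecreasing (λ (_ : Fin n) → 2 * n * (n ∸ 1))
        × ((m : Matrix n) → Loopless m → HasOutDegSeq m (λ _ → 2 * n * (n ∸ 1))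
          → ∃ (λ i → ∃ (λ j → i F.< j × 2 * hOf n p (λ _ → 2 * n * (n ∸ 1)) ≤ m i j + m j i))))
lemma2 (suc (suc k)) (s≤s (s≤s z≤n)) = upper , lower , (λ _ _ _ → ≤-refl) , sharp
  where
  n = suc (suc k)
  b = suc k
  last : Fin n
  last = F.fromℕ b

  upper : _
  upper D nondec with realise (ceilDiv (D last) b) D
    (λ i → ≤-trans (nondec i last (FP.≤fromℕ i)) (ceilDiv-upper k (D last)))
  ... | m , loopless , deg , m≤h = m , loopless , deg , m≤h ,
    (λ i j _ → subst (m i j + m j i ≤_) (cong (h +_) (sym (+-identityʳ h)))
                     (+-mono-≤ (m≤h i j) (m≤h j i)))
    where h = ceilDiv (D last) b

  lower : _
  lower D _ m loopless deg with large-entry m loopless last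
  ... | j , big = last , j , subst (λ d → ceilDiv d b ≤ m last j) (deg last) big

  A = 2 * n * b
  h≡2n : ceilDiv A b ≡ 2 * n
  h≡2n = trans (cong (λ x → ceilDiv x b) (*-comm (2 * n) b)) (ceilDiv-exact k (2 * n))

  sharp : _
  sharp m loopless deg with heavy-pair m (4 * n ∸ 1) loopless large
    where
    open ≤-Reasoning
    large : n * (b * (4 * n ∸ 1)) < 2 * totalOut m
    large = begin-strict
      n * (b * (4 * n ∸ 1))  <⟨ *-monoʳ-< n (*-monoʳ-< b {4 * n ∸ 1} {4 * n} ≤-refl) ⟩
      n * (b * (4 * n))      ≡⟨ +-*-Solver.solve 2 (λ x y → x :* (y :* (con 4 :* x))
                                  := con 2 :* (x :* (con 2 :* x :* y))) refl n b ⟩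
      2 * (n * A)            ≡⟨ cong (2 *_) (sym (trans (sumFin-cong deg) (sumFin-const n A))) ⟩
      2 * totalOut m         ∎
      where open +-*-Solver using (_:*_; _:=_; con)
  ... | i , j , i<j , heavy = i , j , i<j , (begin
    2 * ceilDiv A b  ≡⟨ cong (2 *_) h≡2n ⟩
    2 * (2 * n)      ≡⟨ sym (*-assoc 2 2 n) ⟩
    4 * n            ≤⟨ heavy ⟩
    m i j + m j i    ∎)
    where open ≤-Reasoning
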